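{- Let $f\colon X\to Y$ be a dc-embedding of ultrametric spaces. (1) $f$ is continuous if and only if $D_f$ is continuous at $0$ or $X$ is discrete. (2) $f$ is uniformly continuous if and only if $D_f$ is continuous at $0$ or $X$ is uniformly discrete. In particular, a dc-isomorphism is always a uniform homeomorphism.
   Context: A (two-sorted) ultrametric space is $(X,d_X,D_X)$ with $D_X$ a linear order with least element $0$ and $d_X$ a $D_X$-valued ultrametric. A dc-embedding $X\to Y$ is an injective $f\colon X\to Y$ together with an order embedding $D_f\colon D_X\to D_Y$ with $D_f(0)=0$ such that $d_Y(f(x),f(x'))=D_f(d_X(x,x'))$. The topology and uniformity of $X$ are generated by the balls $B_r(a)=\{x:d_X(x,a)<r\}$, $r\in D_X\setminus\{0\}$: $f$ is continuous if for all $x\in X$ and $\varepsilon\in D_Y\setminus\{0\}$ there is $\delta\in D_X\setminus\{0\}$ with $f[B_\delta(x)]\subseteq B_\varepsilon(f(x))$, and uniformly continuous if $\delta$ can be chosen independently of $x$. $D_f$ is continuous at $0$ if there is no $\varepsilon\in D_Y$ with $0<\varepsilon<D_f(r)$ for all $r\in D_X\setminus\{0\}$. $X$ is discrete if every $x$ has $\varepsilon\in D_X\setminus\{0\}$ with $B_\varepsilon(x)=\{x\}$, and uniformly discrete if $\varepsilon$ can be chosen independently of $x$. -}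

module Defs where

open import Data.Product using (Σ; _×_; _,_; ∃; ∃-syntax)
open import Data.Sum using (_⊎_)
open import Relation.Nullary using (¬_; Dec)
open import Relation.Binary.PropositionalEquality using (_≡_; _≢_)
open import Relation.Binary.Structures using (IsTotalOrder)
open import Function.Bundles using (_⇔_)

-- Excluded middle (for Set); the paper reasons classically.
ExcludedMiddle : Set₁
ExcludedMiddle = (P : Set) → Dec P

-- A two-sorted ultrametric space (X, d_X, D_X): D_X is a linear order with
-- least element 0, d_X is a D_X-valued ultrametric.
record UltrametricSpace : Set₁ where
  field
    Pt       : Set
    Dist     : Set
    _≤_      : Dist → Dist → Set
    isTotal  : IsTotalOrder _≡_ _≤_
    0D       : Dist
    0-least  : ∀ r → 0D ≤ r
    d        : Pt → Pt → Dist
    d-zero   : ∀ x y → (d x y ≡ 0D) ⇔ (x ≡ y)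
    d-sym    : ∀ x y → d x y ≡ d y x
    -- d(x,z) ≤ max(d(x,y), d(y,z)) in a linear order
    d-ultra  : ∀ x y z → (d x z ≤ d x y) ⊎ (d x z ≤ d y z)

  _<_ : Dist → Dist → Set
  r < s = (r ≤ s) × (r ≢ s)

  B : Dist → Pt → Pt → Set
  B r a x = d x a < r


module _ (X Y : UltrametricSpace) where
  private
    module X = UltrametricSpace X
    module Y = UltrametricSpace Y

  record DcEmbedding : Set where
    field
      fun       : X.Pt → Y.Pt
      fun-inj   : ∀ x x' → fun x ≡ fun x' → x ≡ x'
      Df        : X.Dist → Y.Dist
      Df-embed  : ∀ r s → (r X.≤ s) ⇔ (Df r Y.≤ Df s)
      Df-zero   : Df X.0D ≡ Y.0D
      dist-pres : ∀ x x' → Y.d (fun x) (fun x') ≡ Df (X.d x x')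

  Continuous : (X.Pt → Y.Pt) → Set
  Continuous f = ∀ (x : X.Pt) (ε : Y.Dist) → Y.0D Y.< ε →
    ∃[ δ ] (X.0D X.< δ × (∀ x' → X.B δ x x' → Y.B ε (f x) (f x')))

  UniformlyContinuous : (X.Pt → Y.Pt) → Set
  UniformlyContinuous f = ∀ (ε : Y.Dist) → Y.0D Y.< ε →
    ∃[ δ ] (X.0D X.< δ × (∀ x x' → X.B δ x x' → Y.B ε (f x) (f x')))

  ContinuousAt0 : (X.Dist → Y.Dist) → Set
  ContinuousAt0 g = ¬ (∃[ ε ] (Y.0D Y.< ε × (∀ r → X.0D X.< r → ε Y.< g r)))

  IsDcIso : DcEmbedding → Set
  IsDcIso e = (∀ y → ∃[ x ] (DcEmbedding.fun e x ≡ y))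
            × (∀ s → ∃[ r ] (DcEmbedding.Df e r ≡ s))

  UniformHomeo : (X.Pt → Y.Pt) → Set
  UniformHomeo f = Σ (Y.Pt → X.Pt) λ g →
    (∀ x → g (f x) ≡ x) × (∀ y → f (g y) ≡ y) ×
    UniformlyContinuous f × UniformlyContinuous′ g
    where
    UniformlyContinuous′ : (Y.Pt → X.Pt) → Set
    UniformlyContinuous′ g = ∀ (ε : X.Dist) → X.0D X.< ε →
      ∃[ δ ] (Y.0D Y.< δ × (∀ y y' → Y.B δ y y' → X.B ε (g y) (g y')))

Discrete : UltrametricSpace → Set
Discrete X = ∀ x → ∃[ ε ] (X.0D X.< ε × (∀ x' → X.B ε x x' → x' ≡ x))
  where module X = UltrametricSpace X

UniformlyDiscrete : UltrametricSpace → Set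
UniformlyDiscrete X = ∃[ ε ] (X.0D X.< ε × (∀ x x' → X.B ε x x' → x' ≡ x))
  where module X = UltrametricSpace X

{-# OPTIONS --safe #-}
module Submission where

open import Defs
open import Data.Product using (_×_; _,_; proj₁; proj₂; ∃-syntax)
open import Data.Sum using (_⊎_; inj₁; inj₂)
open import Function.Base using (_∘_)
open import Function.Bundles using (_⇔_; mk⇔; Equivalence)
open import Relation.Nullary using (¬_; yes; no)
open import Relation.Nullary.Decidable using (decidable-stable)
open import Relation.Binary.PropositionalEquality using (_≡_; _≢_; refl; sym; trans; cong; cong₂; subst)
open import Relation.Binary.Structures using (IsTotalOrder)
import Relation.Binary.Construct.NonStrictToStrict as NonStrictToStrict

-- Since d_Y(f x', f x) = D_f(d_X(x', x)), everything is decided by the values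
-- of D_f near 0. If they get below every ε > 0, a single δ with D_f(δ) ≤ ε
-- works at every point. Otherwise some ε > 0 lies below all D_f(r) with r > 0,
-- so the ε-ball around f x pulls back to {x}, and continuity at x (uniformly
-- in x) forces a ball around x to be {x}.

module UltrametricSpaceProperties (X : UltrametricSpace) where
  open UltrametricSpace X
  open IsTotalOrder isTotal
    using (antisym; total; reflexive; ≲-respʳ-≈) renaming (trans to ≤-trans)
  private module Strict = NonStrictToStrict _≡_ _≤_

  <-≤-trans : ∀ {r s t} → r < s → s ≤ t → r < t
  <-≤-trans = Strict.<-≤-trans sym ≤-trans antisym ≲-respʳ-≈

  <-irrefl : ∀ {r} → ¬ (r < r)
  <-irrefl = Strict.<-irrefl refl

  ≮⇒≥ : ExcludedMiddle → ∀ {r s} → ¬ (r < s) → s ≤ r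
  ≮⇒≥ em = Strict.≮⇒≥ sym (λ r s → em (r ≡ s)) reflexive total

  ≢0⇒pos : ∀ {r} → r ≢ 0D → 0D < r
  ≢0⇒pos {r} r≢0 = 0-least r , r≢0 ∘ sym

  d-refl : ∀ x → d x x ≡ 0D
  d-refl x = Equivalence.from (d-zero x x) refl

  d-pos : ∀ {x y} → x ≢ y → 0D < d x y
  d-pos {x} {y} x≢y = ≢0⇒pos (x≢y ∘ Equivalence.to (d-zero x y))

  centre∈B : ∀ {r} → 0D < r → ∀ a → B r a a
  centre∈B {r} r>0 a = subst (_< r) (sym (d-refl a)) r>0

module _ (X Y : UltrametricSpace) where
  private
    module X = UltrametricSpace X
    module Y = UltrametricSpace Y
    module YP = UltrametricSpaceProperties Y

  uniformlyContinuous⇒continuous : ∀ {f} → UniformlyContinuous X Y f → Continuous X Y f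
  uniformlyContinuous⇒continuous uc x ε ε>0 with uc ε ε>0
  ... | δ , δ>0 , f[Bδ]⊆Bε = δ , δ>0 , f[Bδ]⊆Bε x

  discrete⇒continuous : ∀ f → Discrete X → Continuous X Y f
  discrete⇒continuous f disc x ε ε>0 with disc x
  ... | δ , δ>0 , Bδ⊆x = δ , δ>0 , λ x' x'∈Bδ →
    subst (Y.B ε (f x) ∘ f) (sym (Bδ⊆x x' x'∈Bδ)) (YP.centre∈B ε>0 (f x))

  uniformlyDiscrete⇒uniformlyContinuous : ∀ f → UniformlyDiscrete X → UniformlyContinuous X Y f
  uniformlyDiscrete⇒uniformlyContinuous f (δ , δ>0 , Bδ⊆x) ε ε>0 =
    δ , δ>0 , λ x x' x'∈Bδ →
      subst (Y.B ε (f x) ∘ f) (sym (Bδ⊆x x x' x'∈Bδ)) (YP.centre∈B ε>0 (f x))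

  Gap : (X.Dist → Y.Dist) → Y.Dist → Set
  Gap g ε = Y.0D Y.< ε × (∀ r → X.0D X.< r → ε Y.< g r)

  continuousAt0⇒small-values : ExcludedMiddle → ∀ {g} → ContinuousAt0 X Y g →
    ∀ ε → Y.0D Y.< ε → ∃[ r ] (X.0D X.< r × g r Y.≤ ε)
  continuousAt0⇒small-values em noGap ε ε>0 =
    decidable-stable (em _) λ noSmall → noGap (ε , ε>0 , λ r r>0 → decidable-stable (em _)
      λ ε≮gr → noSmall (r , r>0 , YP.≮⇒≥ em ε≮gr))

module DcEmbeddingProperties (X Y : UltrametricSpace) (f : DcEmbedding X Y) where
  private
    module X = UltrametricSpace X
    module Y = UltrametricSpace Y
    module XP = UltrametricSpaceProperties X
    module YP = UltrametricSpaceProperties Y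
    module XT = IsTotalOrder X.isTotal
    module YT = IsTotalOrder Y.isTotal
  open DcEmbedding f

  Df-injective : ∀ {r s} → Df r ≡ Df s → r ≡ s
  Df-injective {r} {s} Dr≡Ds =
    XT.antisym (Equivalence.from (Df-embed r s) (YT.reflexive Dr≡Ds))
               (Equivalence.from (Df-embed s r) (YT.reflexive (sym Dr≡Ds)))

  Df-mono-< : ∀ {r s} → r X.< s → Df r Y.< Df s
  Df-mono-< {r} {s} (r≤s , r≢s) = Equivalence.to (Df-embed r s) r≤s , r≢s ∘ Df-injective

  Df-cancel-< : ∀ {r s} → Df r Y.< Df s → r X.< s
  Df-cancel-< {r} {s} (Dr≤Ds , Dr≢Ds) = Equivalence.from (Df-embed r s) Dr≤Ds , Dr≢Ds ∘ cong Df

  Df-pos : ∀ {r} → X.0D X.< r → Y.0D Y.< Df r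
  Df-pos {r} r>0 = subst (Y._< Df r) Df-zero (Df-mono-< r>0)

  fun[B]⊆B : ∀ {δ ε} → Df δ Y.≤ ε → ∀ x x' → X.B δ x x' → Y.B ε (fun x) (fun x')
  fun[B]⊆B {ε = ε} Dδ≤ε x x' x'∈Bδ =
    subst (Y._< ε) (sym (dist-pres x' x)) (YP.<-≤-trans (Df-mono-< x'∈Bδ) Dδ≤ε)

  gap⇒fun⁻¹[B]⊆centre : ExcludedMiddle → ∀ {ε} → Gap X Y Df ε →
    ∀ x x' → Y.B ε (fun x) (fun x') → x' ≡ x
  gap⇒fun⁻¹[B]⊆centre em {ε} (_ , ε<Df) x x' fx'∈Bε = decidable-stable (em _) λ x'≢x →
    YP.<-irrefl (YP.<-≤-trans (ε<Df (X.d x' x) (XP.d-pos x'≢x))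
                              (proj₁ (subst (Y._< ε) (dist-pres x' x) fx'∈Bε)))

  continuousAt0⇒uniformlyContinuous : ExcludedMiddle → ContinuousAt0 X Y Df →
    UniformlyContinuous X Y fun
  continuousAt0⇒uniformlyContinuous em ca0 ε ε>0
    with continuousAt0⇒small-values X Y em ca0 ε ε>0
  ... | δ , δ>0 , Dδ≤ε = δ , δ>0 , fun[B]⊆B Dδ≤ε

  continuous⇒continuousAt0⊎discrete : ExcludedMiddle → Continuous X Y fun →
    ContinuousAt0 X Y Df ⊎ Discrete X
  continuous⇒continuousAt0⊎discrete em cont with em (ContinuousAt0 X Y Df)
  ... | yes ca0 = inj₁ ca0
  ... | no ¬ca0 = inj₂ discrete
    where
    discrete : Discrete X
    discrete x with decidable-stable (em _) ¬ca0
    ... | ε , gap with cont x ε (proj₁ gap)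
    ... | δ , δ>0 , f[Bδ]⊆Bε =
      δ , δ>0 , λ x' x'∈Bδ → gap⇒fun⁻¹[B]⊆centre em gap x x' (f[Bδ]⊆Bε x' x'∈Bδ)

  uniformlyContinuous⇒continuousAt0⊎uniformlyDiscrete : ExcludedMiddle →
    UniformlyContinuous X Y fun → ContinuousAt0 X Y Df ⊎ UniformlyDiscrete X
  uniformlyContinuous⇒continuousAt0⊎uniformlyDiscrete em uc with em (ContinuousAt0 X Y Df)
  ... | yes ca0 = inj₁ ca0
  ... | no ¬ca0 = inj₂ uniformlyDiscrete
    where
    uniformlyDiscrete : UniformlyDiscrete X
    uniformlyDiscrete with decidable-stable (em _) ¬ca0
    ... | ε , gap with uc ε (proj₁ gap)
    ... | δ , δ>0 , f[Bδ]⊆Bε =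
      δ , δ>0 , λ x x' x'∈Bδ → gap⇒fun⁻¹[B]⊆centre em gap x x' (f[Bδ]⊆Bε x x' x'∈Bδ)

  continuousAt0⊎discrete⇒continuous : ExcludedMiddle → ContinuousAt0 X Y Df ⊎ Discrete X →
    Continuous X Y fun
  continuousAt0⊎discrete⇒continuous em (inj₁ ca0) =
    uniformlyContinuous⇒continuous X Y (continuousAt0⇒uniformlyContinuous em ca0)
  continuousAt0⊎discrete⇒continuous em (inj₂ disc) = discrete⇒continuous X Y fun disc

  continuousAt0⊎uniformlyDiscrete⇒uniformlyContinuous : ExcludedMiddle →
    ContinuousAt0 X Y Df ⊎ UniformlyDiscrete X → UniformlyContinuous X Y fun
  continuousAt0⊎uniformlyDiscrete⇒uniformlyContinuous em (inj₁ ca0) =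
    continuousAt0⇒uniformlyContinuous em ca0
  continuousAt0⊎uniformlyDiscrete⇒uniformlyContinuous em (inj₂ ud) =
    uniformlyDiscrete⇒uniformlyContinuous X Y fun ud

  surjective⇒continuousAt0 : (∀ s → ∃[ r ] (Df r ≡ s)) → ContinuousAt0 X Y Df
  surjective⇒continuousAt0 Df-surj (ε , ε>0 , ε<Df) with Df-surj ε
  ... | r , Dr≡ε = YP.<-irrefl (subst (ε Y.<_) Dr≡ε (ε<Df r r>0))
    where
    r>0 : X.0D X.< r
    r>0 = XP.≢0⇒pos λ r≡0 → proj₂ ε>0 (trans (sym Df-zero) (trans (cong Df (sym r≡0)) Dr≡ε))

  inverse-uniformlyContinuous : ∀ {g} → (∀ y → fun (g y) ≡ y) → UniformlyContinuous Y X g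
  inverse-uniformlyContinuous {g} fg≗id ε ε>0 = Df ε , Df-pos ε>0 , λ y y' y'∈B →
    Df-cancel-< (subst (Y._< Df ε) (d≡Df∘d y' y) y'∈B)
    where
    d≡Df∘d : ∀ y y' → Y.d y y' ≡ Df (X.d (g y) (g y'))
    d≡Df∘d y y' = trans (cong₂ Y.d (sym (fg≗id y)) (sym (fg≗id y'))) (dist-pres (g y) (g y'))

  dcIso⇒uniformHomeo : ExcludedMiddle → IsDcIso X Y f → UniformHomeo X Y fun
  dcIso⇒uniformHomeo em (fun-surj , Df-surj) =
    g , gf≗id , fg≗id , continuousAt0⇒uniformlyContinuous em (surjective⇒continuousAt0 Df-surj) ,
    inverse-uniformlyContinuous fg≗id
    where
    g : Y.Pt → X.Pt
    g y = proj₁ (fun-surj y)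
    fg≗id : ∀ y → fun (g y) ≡ y
    fg≗id y = proj₂ (fun-surj y)
    gf≗id : ∀ x → g (fun x) ≡ x
    gf≗id x = fun-inj _ _ (fg≗id (fun x))

lemma2p13 : ExcludedMiddle → (X Y : UltrametricSpace) → (f : DcEmbedding X Y) →
    ((Continuous X Y (DcEmbedding.fun f) ⇔ (ContinuousAt0 X Y (DcEmbedding.Df f) ⊎ Discrete X))
    × (UniformlyContinuous X Y (DcEmbedding.fun f) ⇔ (ContinuousAt0 X Y (DcEmbedding.Df f) ⊎ UniformlyDiscrete X)))
    × (IsDcIso X Y f → UniformHomeo X Y (DcEmbedding.fun f))
lemma2p13 em X Y f =
  ( mk⇔ (continuous⇒continuousAt0⊎discrete em) (continuousAt0⊎discrete⇒continuous em)
  , mk⇔ (uniformlyContinuous⇒continuousAt0⊎uniformlyDiscrete em)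
        (continuousAt0⊎uniformlyDiscrete⇒uniformlyContinuous em) )
  , dcIso⇒uniformHomeo em
  where open DcEmbeddingProperties X Y f
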